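{- Let $M$ be a finite LTS and $B\subseteq\mathit{Act}$. Every path that satisfies a finitely realisable path predicate $P$ (with respect to $B$) is $B$-progressing.
   Context: LTS $M=(S,s_{init},\mathit{Act},\mathit{Trans})$ with $S,\mathit{Act}$ finite. Paths: alternating sequences $s_0t_1s_1\dots$ starting in a state, infinite or ending in a state (final state), consecutive. An action occurs on a path if a transition on it carries that label. An action is enabled in $s$ if a transition with that label leaves $s$. $\overline{B}=\mathit{Act}\setminus B$. A state is $B$-locked if all actions enabled in it are in $B$; a path is $B$-progressing if infinite or its final state is $B$-locked. A path predicate $P$ is finitely realisable if there are mappings $\phi_{on},\phi_{off}$ from $\overline{B}$ to closed modal $\mu$-calculus formulae and $\alpha_{el}$ from $\overline{B}$ to subsets of $\mathit{Act}$ such that: (1) a path $\pi$ satisfies $P$ iff for every state $s$ on $\pi$ and every $a\in\overline{B}$ with $s\in[\![\phi_{on}(a)]\!]$, the suffix of $\pi$ from $s$ contains an occurrence of an action in $\alpha_{el}(a)$ or a state satisfying $\phi_{off}(a)$; (2) $s$ is $B$-locked iff $s\notin[\![\phi_{on}(a)]\!]$ for all $a\in\overline{B}$; (3) $s\in[\![\phi_{on}(a)]\!]$ implies $s\notin[\![\phi_{off}(a)]\!]$; (4) if $s\in[\![\phi_{on}(a)]\!]$ and a finite path from $s$ to $s'$ contains no occurrence of an action in $\alpha_{el}(a)$ and no state satisfying $\phi_{off}(a)$, then $s'\in[\![\phi_{on}(a)]\!]$. Here $[\![\phi]\!]$ is the set of states satisfying the closed formula $\phi$ under the standard modal $\mu$-calculus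 semantics. -}

module Defs where

open import Data.Nat using (ℕ; zero; suc; _<_; _≤_)
open import Data.Fin using (Fin; zero; suc)
open import Data.Fin.Subset using (Subset; _∈_; _∉_)
open import Data.Bool using (Bool; true; false; _∧_; _∨_; not)
open import Data.List using (List; []; _∷_; concatMap; allFin)
open import Data.Bool.ListAction using (all; any)
open import Data.Maybe using (Maybe; just; nothing)
open import Data.Product using (Σ; ∃; _×_; _,_; proj₁)
open import Data.Sum using (_⊎_)
open import Data.Empty using (⊥)
open import Data.Unit using (⊤)
open import Relation.Nullary using (¬_)
open import Relation.Binary.PropositionalEquality using (_≡_)

record LTS (n m : ℕ) : Set where
  field
    sinit : Fin n
    Trans : Fin n → Fin m → Fin n → Bool

-- Modal μ-calculus (positive normal form), formulae with k free
-- (de Bruijn) fixpoint variables; closed formulae are Form m 0.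

data Form (m : ℕ) : ℕ → Set where
  tt ff : ∀ {k} → Form m k
  var   : ∀ {k} → Fin k → Form m k
  _∧ᶠ_ _∨ᶠ_ : ∀ {k} → Form m k → Form m k → Form m k
  ⟨_⟩_ [_]_ : ∀ {k} → Fin m → Form m k → Form m k
  μ ν   : ∀ {k} → Form m (suc k) → Form m k

ClosedForm : ℕ → Set
ClosedForm m = Form m 0

StSet : ℕ → Set
StSet n = Fin n → Bool

consSet : ∀ {n} → Bool → StSet n → StSet (suc n)
consSet b U zero    = b
consSet b U (suc i) = U i

allSets : ∀ n → List (StSet n)
allSets zero    = (λ ()) ∷ []
allSets (suc n) = concatMap (λ U → consSet false U ∷ consSet true U ∷ []) (allSets n)

_⊆ᵇ_ : ∀ {n} → StSet n → StSet n → Bool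
_⊆ᵇ_ {n} U V = all (λ s → not (U s) ∨ V s) (allFin n)

extEnv : ∀ {n k} → (Fin k → StSet n) → StSet n → Fin (suc k) → StSet n
extEnv ρ U zero    = U
extEnv ρ U (suc i) = ρ i

-- standard semantics; fixpoints via Knaster–Tarski:
-- μ = intersection of all pre-fixed points, ν = union of all post-fixed points
sem : ∀ {n m k} → LTS n m → Form m k → (Fin k → StSet n) → StSet n
sem M tt ρ s = true
sem M ff ρ s = false
sem M (var x) ρ s = ρ x s
sem M (φ ∧ᶠ ψ) ρ s = sem M φ ρ s ∧ sem M ψ ρ s
sem M (φ ∨ᶠ ψ) ρ s = sem M φ ρ s ∨ sem M ψ ρ s
sem {n} M (⟨ a ⟩ φ) ρ s = any (λ s' → LTS.Trans M s a s' ∧ sem M φ ρ s') (allFin n)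
sem {n} M ([ a ] φ) ρ s = all (λ s' → not (LTS.Trans M s a s') ∨ sem M φ ρ s') (allFin n)
sem {n} M (μ φ) ρ s = all (λ U → not (sem M φ (extEnv ρ U) ⊆ᵇ U) ∨ U s) (allSets n)
sem {n} M (ν φ) ρ s = any (λ U → (U ⊆ᵇ sem M φ (extEnv ρ U)) ∧ U s) (allSets n)

_⊨_ : ∀ {n m} → (M : LTS n m) → ClosedForm m → Fin n → Set
(M ⊨ φ) s = sem M φ (λ ()) s ≡ true

-- Paths.  len = nothing: infinite path; len = just k: finite path with
-- k transitions and states st 0 … st k (final state st k).
-- Values of st/ac outside the range are irrelevant.

InTrans : Maybe ℕ → ℕ → Set
InTrans nothing  i = ⊤
InTrans (just k) i = i < k

InState : Maybe ℕ → ℕ → Set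
InState nothing  i = ⊤
InState (just k) i = i ≤ k

record Path {n m : ℕ} (M : LTS n m) : Set where
  field
    len   : Maybe ℕ
    st    : ℕ → Fin n
    ac    : ℕ → Fin m
    valid : ∀ i → InTrans len i → LTS.Trans M (st i) (ac i) (st (suc i)) ≡ true

module _ {n m : ℕ} (M : LTS n m) where

  Enabled : Fin m → Fin n → Set
  Enabled a s = ∃ λ s' → LTS.Trans M s a s' ≡ true

  Locked : Subset m → Fin n → Set
  Locked B s = ∀ a → Enabled a s → a ∈ B

  Progressing : Subset m → Path M → Set
  Progressing B π with Path.len π
  ... | nothing = ⊤
  ... | just k  = Locked B (Path.st π k)

  SuffixHits : Path M → ℕ → Subset m → ClosedForm m → Set
  SuffixHits π i α φ =
      (∃ λ j → i ≤ j × InTrans (Path.len π) j × Path.ac π j ∈ α)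
    ⊎ (∃ λ j → i ≤ j × InState (Path.len π) j × (M ⊨ φ) (Path.st π j))

  NotIn : Subset m → Set
  NotIn B = Σ (Fin m) (λ a → a ∉ B)

  record FinitelyRealisable (B : Subset m) (P : Path M → Set) : Set where
    field
      φon φoff : NotIn B → ClosedForm m
      αel      : NotIn B → Subset m
      -- (1)
      char : ∀ π → (P π → (∀ i → InState (Path.len π) i → ∀ a →
                             (M ⊨ φon a) (Path.st π i) → SuffixHits π i (αel a) (φoff a)))
                 × ((∀ i → InState (Path.len π) i → ∀ a →
                             (M ⊨ φon a) (Path.st π i) → SuffixHits π i (αel a) (φoff a)) → P π)
      -- (2)
      locked : ∀ s → (Locked B s → ∀ a → ¬ (M ⊨ φon a) s)
                   × ((∀ a → ¬ (M ⊨ φon a) s) → Locked B s)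
      -- (3)
      onOff : ∀ a s → (M ⊨ φon a) s → ¬ (M ⊨ φoff a) s
      -- (4)
      stable : ∀ a (π : Path M) k → Path.len π ≡ just k →
               (M ⊨ φon a) (Path.st π 0) →
               (∀ j → j < k → Path.ac π j ∉ αel a) →
               (∀ j → j ≤ k → ¬ (M ⊨ φoff a) (Path.st π j)) →
               (M ⊨ φon a) (Path.st π k)

{-# OPTIONS --safe #-}
module Submission where

open import Defs
open import Data.Nat.Properties using (≤-refl; ≤-antisym; <⇒≱)
open import Data.Fin.Subset using (Subset)
open import Data.Maybe using (just; nothing)
open import Data.Product using (_,_; proj₁; proj₂)
open import Data.Sum using (inj₁; inj₂)
open import Data.Unit using (tt)
open import Data.Empty using (⊥-elim)
open import Relation.Nullary using (¬_)
open import Relation.Binary.PropositionalEquality using (_≡_; subst)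

-- On a finite path an obligation raised in the final state can only be
-- discharged by that state itself satisfying φoff, which (3) forbids.
-- Hence no φon holds in the final state, and by (2) it is B-locked.

module _ {n m} {M : LTS n m} where

  final-InState : ∀ (π : Path M) {k} → Path.len π ≡ just k → InState (Path.len π) k
  final-InState π eq rewrite eq = ≤-refl

  suffixHits-final⇒⊨ : ∀ (π : Path M) {k} → Path.len π ≡ just k →
                       ∀ {α φ} → SuffixHits M π k α φ → (M ⊨ φ) (Path.st π k)
  suffixHits-final⇒⊨ π eq {φ = φ} hits rewrite eq with hits
  ... | inj₁ (j , k≤j , j<k , _)  = ⊥-elim (<⇒≱ j<k k≤j)
  ... | inj₂ (j , k≤j , j≤k , ⊨φ) = subst (λ i → (M ⊨ φ) (Path.st π i)) (≤-antisym j≤k k≤j) ⊨φ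

module _ {n m} {M : LTS n m} {B : Subset m} {P : Path M → Set}
         (fr : FinitelyRealisable M B P) where
  open FinitelyRealisable fr

  final-¬φon : ∀ (π : Path M) {k} → Path.len π ≡ just k → P π →
               ∀ a → ¬ (M ⊨ φon a) (Path.st π k)
  final-¬φon π {k} eq p a ⊨on = onOff a _ ⊨on (suffixHits-final⇒⊨ π eq {φ = φoff a} obligation)
    where obligation = proj₁ (char π) p k (final-InState π eq) a ⊨on

  final-Locked : ∀ (π : Path M) {k} → Path.len π ≡ just k → P π → Locked M B (Path.st π k)
  final-Locked π eq p = proj₂ (locked _) (final-¬φon π eq p)

proposition47 : ∀ {n m} (M : LTS n m) (B : Subset m) (P : Path M → Set) →
                FinitelyRealisable M B P → ∀ (π : Path M) → P π → Progressing M B π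
proposition47 M B P fr π p with Path.len π in eq
... | nothing = tt
... | just k  = final-Locked fr π eq p
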